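{- Let $G=(V,E\cup\overrightarrow{T})$ be a mixed graph in which $E$ is a set of undirected edges and $\overrightarrow{T}$ is a set of arcs forming a spanning tree of $V$ with every arc directed towards the root $d$. Partition $E$ into the back edges $B$ (edges $uv\in E$ such that one endpoint is a descendant of the other in the tree) and the cross edges $C$ (edges $uv\in E$ whose endpoints have no ancestor/descendant relationship). Let $\overrightarrow{B}$ orient each back edge from the descendant to the ancestor. Fix a depth-first search of the tree $T$ from $d$ and its pre-order (the order in which vertices are first visited); let $\overrightarrow{C}$ orient each edge of $C$ from the endpoint with lower pre-order to the endpoint with higher pre-order, and let $\overleftarrow{C}$ be the reverse orientation. Then both $(V,\overrightarrow{T}\cup\overrightarrow{B}\cup\overrightarrow{C})$ and $(V,\overrightarrow{T}\cup\overrightarrow{B}\cup\overleftarrow{C})$ are acyclic.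
   Context: Ancestor/descendant is with respect to the tree $T$ rooted at $d$ (a vertex is its own ancestor only trivially; $u$ is a descendant of $v$ if $v$ lies on the tree path from $u$ to $d$). -}

module Defs where

open import Data.Nat using (ℕ; zero; suc)
open import Data.Fin using (Fin)
open import Data.List using (List; []; _∷_; _++_; concat)
open import Data.List.Membership.Propositional using (_∈_)
open import Data.List.Relation.Unary.Unique.Propositional using (Unique)
open import Data.List.Relation.Binary.Pointwise using (Pointwise)
open import Data.Product using (Σ; ∃; _×_; _,_)
open import Data.Sum using (_⊎_)
open import Data.Empty using (⊥)
open import Function using (_⇔_)
open import Relation.Nullary using (¬_)
open import Relation.Binary.PropositionalEquality using (_≡_; _≢_)
open import Relation.Binary.Construct.Closure.Transitive using (TransClosure)

iter : ∀ {n} → (Fin n → Fin n) → ℕ → Fin n → Fin n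
iter p zero    v = v
iter p (suc k) v = iter p k (p v)

-- The rooted spanning tree T on vertex set Fin n, root d, given by a parent
-- map `par` (convention: par d ≡ d, the root has no outgoing tree arc).
record RootedTree (n : ℕ) : Set where
  field
    root     : Fin n
    par      : Fin n → Fin n
    par-root : par root ≡ root
    reaches  : ∀ v → ∃ λ k → iter par k v ≡ root
open RootedTree public

Ancestor : ∀ {n} → RootedTree n → Fin n → Fin n → Set
Ancestor T a u = ∃ λ k → iter (par T) k u ≡ a

TreeArc : ∀ {n} → RootedTree n → Fin n → Fin n → Set
TreeArc T u v = (u ≢ root T) × (par T u ≡ v)

Child : ∀ {n} → RootedTree n → Fin n → Fin n → Set
Child T v c = TreeArc T c v

-- DFSPreorder T v xs : xs is the pre-order (order of first visit) of some
-- depth-first search of the subtree of T rooted at v: first v, then, for the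
-- children of v taken in some order cs (each child exactly once), the
-- pre-orders of their subtrees, concatenated.
data DFSPreorder {n} (T : RootedTree n) (v : Fin n) : List (Fin n) → Set where
  visit : (cs : List (Fin n)) → Unique cs → (∀ c → (c ∈ cs) ⇔ Child T v c) →
          (ls : List (List (Fin n))) → Pointwise (DFSPreorder T) cs ls →
          DFSPreorder T v (v ∷ concat ls)

Before : ∀ {n} → List (Fin n) → Fin n → Fin n → Set
Before xs u w = ∃ λ ys → ∃ λ zs → ∃ λ ws → xs ≡ ys ++ u ∷ zs ++ w ∷ ws

EdgeE : ∀ {n} → (Fin n → Fin n → Set) → Fin n → Fin n → Set
EdgeE E u v = E u v ⊎ E v u

BackArc : ∀ {n} → RootedTree n → (Fin n → Fin n → Set) → Fin n → Fin n → Set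
BackArc T E u v = EdgeE E u v × Ancestor T v u × (u ≢ v)

CrossEdge : ∀ {n} → RootedTree n → (Fin n → Fin n → Set) → Fin n → Fin n → Set
CrossEdge T E u v = EdgeE E u v × ¬ Ancestor T u v × ¬ Ancestor T v u

ArcFwd : ∀ {n} → RootedTree n → (Fin n → Fin n → Set) → List (Fin n) → Fin n → Fin n → Set
ArcFwd T E xs u v = TreeArc T u v ⊎ BackArc T E u v ⊎ (CrossEdge T E u v × Before xs u v)

ArcBwd : ∀ {n} → RootedTree n → (Fin n → Fin n → Set) → List (Fin n) → Fin n → Fin n → Set
ArcBwd T E xs u v = TreeArc T u v ⊎ BackArc T E u v ⊎ (CrossEdge T E u v × Before xs v u)

Acyclic : ∀ {n} → (Fin n → Fin n → Set) → Set
Acyclic {n} R = ∀ (v : Fin n) → ¬ TransClosure R v v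

-- Every arc of T→ ∪ B→ goes from a vertex to one of its proper
-- ancestors, and a DFS visits ancestors before descendants in pre-order and
-- after them in post-order.  For a cross edge (incomparable endpoints) the
-- subtree of the earlier endpoint is left before the later one is entered, so
-- pre-order and post-order agree on it.  Hence
--   * every arc of T→ ∪ B→ ∪ C← strictly decreases the pre-order, and
--   * every arc of T→ ∪ B→ ∪ C→ strictly increases the post-order;
-- a digraph whose arcs lie in a strict order is acyclic.

module Submission where

open import Defs
open import Data.Nat using (ℕ; zero; suc; _+_; _*_)
open import Data.Nat.Properties using (*-suc)
open import Data.Fin using (Fin)
open import Data.Fin.Properties using (_≟_)
open import Data.List using (List; []; _∷_; _++_; concat)
open import Data.List.Membership.Propositional using (_∈_)
open import Data.List.Membership.Propositional.Properties using (∈-++⁺ˡ; ∈-++⁺ʳ; ∈-++⁻)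
open import Data.List.Relation.Unary.Any using (here; there)
open import Data.List.Relation.Unary.All as All using ()
open import Data.List.Relation.Unary.AllPairs using ([]; _∷_)
open import Data.List.Relation.Unary.Unique.Propositional using (Unique)
open import Data.List.Relation.Unary.Unique.Propositional.Properties using (++⁺)
open import Data.List.Relation.Binary.Pointwise as Pointwise using (Pointwise; []; _∷_)
open import Data.Product using (∃; _×_; _,_; proj₂)
open import Data.Sum using (_⊎_; inj₁; inj₂)
open import Data.Empty using (⊥-elim)
open import Function using (_⇔_; Equivalence; flip)
open import Relation.Nullary using (¬_; yes; no)
open import Relation.Binary.PropositionalEquality using (_≡_; _≢_; refl; sym; trans; cong; module ≡-Reasoning)
open import Relation.Binary.Construct.Closure.Transitive using (TransClosure; [_]; _∷_)

private
  variable
    A : Set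
    x y z : A
    xs ys : List A

data Precedes {A : Set} (x y : A) : List A → Set where
  at-head : ∀ {zs} → y ∈ zs → Precedes x y (x ∷ zs)
  in-tail : ∀ {z zs} → Precedes x y zs → Precedes x y (z ∷ zs)

precedes-∈ : Precedes x y xs → y ∈ xs
precedes-∈ (at-head y∈) = there y∈
precedes-∈ (in-tail p)  = there (precedes-∈ p)

precedes-irrefl : Unique xs → ¬ Precedes x x xs
precedes-irrefl (x∉ ∷ _)   (at-head x∈) = All.lookup x∉ x∈ refl
precedes-irrefl (_ ∷ uniq) (in-tail p)  = precedes-irrefl uniq p

precedes-trans : Unique xs → Precedes x y xs → Precedes y z xs → Precedes x z xs
precedes-trans (x∉ ∷ _)   (at-head y∈) (at-head _) = ⊥-elim (All.lookup x∉ y∈ refl)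
precedes-trans _          (at-head _)  (in-tail q) = at-head (precedes-∈ q)
precedes-trans (y∉ ∷ _)   (in-tail p)  (at-head _) = ⊥-elim (All.lookup y∉ (precedes-∈ p) refl)
precedes-trans (_ ∷ uniq) (in-tail p)  (in-tail q) = in-tail (precedes-trans uniq p q)

precedes-++ˡ : ∀ ys → Precedes x y xs → Precedes x y (xs ++ ys)
precedes-++ˡ ys (at-head y∈) = at-head (∈-++⁺ˡ y∈)
precedes-++ˡ ys (in-tail p)  = in-tail (precedes-++ˡ ys p)

precedes-++ʳ : ∀ xs → Precedes x y ys → Precedes x y (xs ++ ys)
precedes-++ʳ []       p = p
precedes-++ʳ (_ ∷ xs) p = in-tail (precedes-++ʳ xs p)

precedes-across : x ∈ xs → y ∈ ys → Precedes x y (xs ++ ys)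
precedes-across {xs = _ ∷ xs} (here refl) y∈ = at-head (∈-++⁺ʳ xs y∈)
precedes-across               (there x∈)  y∈ = in-tail (precedes-across x∈ y∈)

precedes-++⁻ : ∀ xs → Precedes x y (xs ++ ys) →
               Precedes x y xs ⊎ (x ∈ xs × y ∈ ys) ⊎ Precedes x y ys
precedes-++⁻ []       p = inj₂ (inj₂ p)
precedes-++⁻ (_ ∷ xs) (at-head y∈) with ∈-++⁻ xs y∈
... | inj₁ y∈xs = inj₁ (at-head y∈xs)
... | inj₂ y∈ys = inj₂ (inj₁ (here refl , y∈ys))
precedes-++⁻ (_ ∷ xs) (in-tail p) with precedes-++⁻ xs p
... | inj₁ within          = inj₁ (in-tail within)
... | inj₂ (inj₁ (x∈ , y∈)) = inj₂ (inj₁ (there x∈ , y∈))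
... | inj₂ (inj₂ within)   = inj₂ (inj₂ within)

before⇒precedes : ∀ {n} {u w : Fin n} {xs} → Before xs u w → Precedes u w xs
before⇒precedes (ys , zs , ws , refl) = go ys
  where
  go : ∀ ys → Precedes _ _ (ys ++ _ ∷ zs ++ _ ∷ ws)
  go []       = at-head (∈-++⁺ʳ zs (here refl))
  go (_ ∷ ys) = in-tail (go ys)

acyclic-within : ∀ {n} {R S : Fin n → Fin n → Set} →
                 (∀ {u w} → R u w → S u w) →
                 (∀ {u v w} → S u v → S v w → S u w) → (∀ {u} → ¬ S u u) →
                 Acyclic R
acyclic-within {R = R} {S} R⊆S S-trans S-irrefl v cycle = S-irrefl (walk cycle)
  where
  walk : ∀ {u w} → TransClosure R u w → S u w
  walk [ r ]    = R⊆S r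
  walk (r ∷ rs) = S-trans (R⊆S r) (walk rs)

iter-+ : ∀ {n} (p : Fin n → Fin n) j k x → iter p (j + k) x ≡ iter p k (iter p j x)
iter-+ p zero    k x = refl
iter-+ p (suc j) k x = iter-+ p j k (p x)

iter-periodic : ∀ {n} (p : Fin n → Fin n) {m x} → iter p m x ≡ x → ∀ j → iter p (j * m) x ≡ x
iter-periodic p         per zero    = refl
iter-periodic p {m} {x} per (suc j) = begin
  iter p (m + j * m) x           ≡⟨ iter-+ p m (j * m) x ⟩
  iter p (j * m) (iter p m x)    ≡⟨ cong (iter p (j * m)) per ⟩
  iter p (j * m) x               ≡⟨ iter-periodic p per j ⟩
  x                              ∎
  where open ≡-Reasoning

module TreeFacts {n : ℕ} (T : RootedTree n) where

  private
    P = par T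
    d = root T

  Anc : Fin n → Fin n → Set
  Anc = Ancestor T

  ProperAnc : Fin n → Fin n → Set
  ProperAnc a u = Anc a u × a ≢ u

  Incomparable : Fin n → Fin n → Set
  Incomparable u w = ¬ Anc u w × ¬ Anc w u

  iter-root : ∀ k → iter P k d ≡ d
  iter-root zero    = refl
  iter-root (suc k) rewrite par-root T = iter-root k

  -- Since every vertex reaches the root, the root is the only vertex lying
  -- on a cycle of the parent map.
  only-root-recurs : ∀ k {x} → iter P (suc k) x ≡ x → x ≡ d
  only-root-recurs k {x} per with reaches T x
  ... | r , x↝d = begin
    x                             ≡⟨ sym (iter-periodic P per r) ⟩
    iter P (r * suc k) x          ≡⟨ cong (λ m → iter P m x) (*-suc r k) ⟩
    iter P (r + r * k) x          ≡⟨ iter-+ P r (r * k) x ⟩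
    iter P (r * k) (iter P r x)   ≡⟨ cong (iter P (r * k)) x↝d ⟩
    iter P (r * k) d              ≡⟨ iter-root (r * k) ⟩
    d                             ∎
    where open ≡-Reasoning

  anc-trans : ∀ {a b u} → Anc a b → Anc b u → Anc a u
  anc-trans {u = u} (j , b↝a) (k , u↝b) =
    k + j , trans (iter-+ P k j u) (trans (cong (iter P j) u↝b) b↝a)

  tree-arc-ancestor : ∀ {u w} → TreeArc T u w → ProperAnc w u
  tree-arc-ancestor {u} (u≢d , pu≡w) =
    (1 , pu≡w) , λ w≡u → u≢d (only-root-recurs 0 (trans pu≡w w≡u))

  child-not-ancestor : ∀ {v c} → Child T v c → ¬ Anc c v
  child-not-ancestor (c≢d , pc≡v) (k , v↝c) =
    c≢d (only-root-recurs k (trans (cong (iter P k) pc≡v) v↝c))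

  on-path-comparable : ∀ {a b} j k u → iter P j u ≡ a → iter P k u ≡ b → Anc a b ⊎ Anc b a
  on-path-comparable zero    k       u refl u↝b = inj₂ (k , u↝b)
  on-path-comparable (suc j) zero    u u↝a refl = inj₁ (suc j , u↝a)
  on-path-comparable (suc j) (suc k) u u↝a u↝b  = on-path-comparable j k (P u) u↝a u↝b

  children-disjoint : ∀ {v c c' u} → Child T v c → Child T v c' → Anc c u → Anc c' u → c ≡ c'
  children-disjoint c-ch c'-ch (j , u↝c) (k , u↝c') with on-path-comparable j k _ u↝c u↝c'
  ... | inj₁ (zero , c'≡c)   = sym c'≡c
  ... | inj₁ (suc i , c'↝c)  =
    ⊥-elim (child-not-ancestor c-ch (i , trans (cong (iter P i) (sym (proj₂ c'-ch))) c'↝c))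
  ... | inj₂ (zero , c≡c')   = c≡c'
  ... | inj₂ (suc i , c↝c')  =
    ⊥-elim (child-not-ancestor c'-ch (i , trans (cong (iter P i) (sym (proj₂ c-ch))) c↝c'))

  child-towards : ∀ {v} k u → iter P k u ≡ v → u ≢ v → ∃ λ c → Child T v c × Anc c u
  child-towards zero    u u≡v u≢v = ⊥-elim (u≢v u≡v)
  child-towards {v} (suc k) u pu↝v u≢v with P u ≟ v
  ... | yes pu≡v = u , (u≢d , pu≡v) , (0 , refl)
    where
    u≢d : u ≢ d
    u≢d u≡d = u≢v (trans u≡d (trans (sym (par-root T)) (trans (cong P (sym u≡d)) pu≡v)))
  ... | no pu≢v with child-towards k (P u) pu↝v pu≢v
  ...   | c , c-ch , (j , pu↝c) = c , c-ch , (suc j , pu↝c)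

module DFSOrders {n : ℕ} (T : RootedTree n) where

  open TreeFacts T

  record Enumerates (v : Fin n) (xs : List (Fin n)) : Set where
    field
      unique   : Unique xs
      sound    : ∀ {u} → u ∈ xs → Anc v u
      complete : ∀ {u} → Anc v u → u ∈ xs
  open Enumerates

  record Orders (v : Fin n) (pre : List (Fin n)) : Set where
    field
      pre-enum           : Enumerates v pre
      post               : List (Fin n)
      post-enum          : Enumerates v post
      ancestors-first    : ∀ {a u} → Anc v a → ProperAnc a u → Precedes a u pre
      descendants-first  : ∀ {a u} → Anc v a → ProperAnc a u → Precedes u a post
      incomparable-agree : ∀ {u w} → Incomparable u w → Precedes u w pre → Precedes u w post
  open Orders

  posts : ∀ {cs ls} → Pointwise Orders cs ls → List (List (Fin n))
  posts []         = []
  posts (o ∷ sub)  = post o ∷ posts sub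

  pres-enum : ∀ {cs ls} → Pointwise Orders cs ls → Pointwise Enumerates cs ls
  pres-enum = Pointwise.map pre-enum

  posts-enum : ∀ {cs ls} → (sub : Pointwise Orders cs ls) → Pointwise Enumerates cs (posts sub)
  posts-enum []        = []
  posts-enum (o ∷ sub) = post-enum o ∷ posts-enum sub

  block-of : ∀ {cs Ls u} → Pointwise Enumerates cs Ls → u ∈ concat Ls → ∃ λ c → c ∈ cs × Anc c u
  block-of {Ls = L ∷ _} (e ∷ es) u∈ with ∈-++⁻ L u∈
  ... | inj₁ u∈L = _ , here refl , sound e u∈L
  ... | inj₂ u∈rest with block-of es u∈rest
  ...   | c , c∈ , c↝u = c , there c∈ , c↝u

  in-block : ∀ {cs Ls c u} → Pointwise Enumerates cs Ls → c ∈ cs → Anc c u → u ∈ concat Ls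
  in-block              (e ∷ _)  (here refl) c↝u = ∈-++⁺ˡ (complete e c↝u)
  in-block {Ls = L ∷ _} (_ ∷ es) (there c∈) c↝u = ∈-++⁺ʳ L (in-block es c∈ c↝u)

  blocks-unique : ∀ {v cs Ls} → (∀ {c} → c ∈ cs → Child T v c) → Unique cs →
                  Pointwise Enumerates cs Ls → Unique (concat Ls)
  blocks-unique children []            []       = []
  blocks-unique children (c∉ ∷ distinct) (e ∷ es) =
    ++⁺ (unique e) (blocks-unique (λ c∈ → children (there c∈)) distinct es) disjoint
    where
    disjoint : ∀ {u} → ¬ (u ∈ _ × u ∈ _)
    disjoint (u∈L , u∈rest) with block-of es u∈rest
    ... | c' , c'∈ , c'↝u = All.lookup c∉ c'∈
      (children-disjoint (children (here refl)) (children (there c'∈)) (sound e u∈L) c'↝u)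

  blocks-ancestors-first : ∀ {cs ls a u} → (sub : Pointwise Orders cs ls) →
                           a ∈ concat ls → ProperAnc a u → Precedes a u (concat ls)
  blocks-ancestors-first {ls = l ∷ ls} (o ∷ sub) a∈ a↝u with ∈-++⁻ l a∈
  ... | inj₁ a∈l    = precedes-++ˡ (concat ls) (ancestors-first o (sound (pre-enum o) a∈l) a↝u)
  ... | inj₂ a∈rest = precedes-++ʳ l (blocks-ancestors-first sub a∈rest a↝u)

  blocks-descendants-first : ∀ {cs ls a u} → (sub : Pointwise Orders cs ls) →
                             a ∈ concat ls → ProperAnc a u → Precedes u a (concat (posts sub))
  blocks-descendants-first {ls = l ∷ _} (o ∷ sub) a∈ a↝u with ∈-++⁻ l a∈
  ... | inj₁ a∈l    = precedes-++ˡ (concat (posts sub)) (descendants-first o (sound (pre-enum o) a∈l) a↝u)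
  ... | inj₂ a∈rest = precedes-++ʳ (post o) (blocks-descendants-first sub a∈rest a↝u)

  -- Across two blocks both orders list the earlier block first.
  blocks-incomparable-agree : ∀ {cs ls u w} → (sub : Pointwise Orders cs ls) → Incomparable u w →
                              Precedes u w (concat ls) → Precedes u w (concat (posts sub))
  blocks-incomparable-agree {ls = l ∷ _} (o ∷ sub) inc u<w with precedes-++⁻ l u<w
  ... | inj₁ within-l    = precedes-++ˡ (concat (posts sub)) (incomparable-agree o inc within-l)
  ... | inj₂ (inj₂ rest) = precedes-++ʳ (post o) (blocks-incomparable-agree sub inc rest)
  ... | inj₂ (inj₁ (u∈l , w∈rest)) with block-of (pres-enum sub) w∈rest
  ...   | c , c∈ , c↝w = precedes-across (complete (post-enum o) (sound (pre-enum o) u∈l))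
                                         (in-block (posts-enum sub) c∈ c↝w)

  module Step (v : Fin n) (cs : List (Fin n)) (distinct : Unique cs)
              (is-children : ∀ c → (c ∈ cs) ⇔ Child T v c)
              (ls : List (List (Fin n))) (sub : Pointwise Orders cs ls) where

    children : ∀ {c} → c ∈ cs → Child T v c
    children {c} = Equivalence.to (is-children c)

    below-v : ∀ {c u} → c ∈ cs → Anc c u → Anc v u
    below-v c∈ c↝u = anc-trans (1 , proj₂ (children c∈)) c↝u

    descendant-split : ∀ {u} → Anc v u → u ≡ v ⊎ ∃ λ c → c ∈ cs × Anc c u
    descendant-split {u} (k , u↝v) with u ≟ v
    ... | yes u≡v = inj₁ u≡v
    ... | no u≢v with child-towards k u u↝v u≢v
    ...   | c , c-ch , c↝u = inj₂ (c , Equivalence.from (is-children c) c-ch , c↝u)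

    v∉blocks : ∀ {Ls} → Pointwise Enumerates cs Ls → ¬ v ∈ concat Ls
    v∉blocks es v∈ with block-of es v∈
    ... | c , c∈ , c↝v = child-not-ancestor (children c∈) c↝v

    pre-enumerates : Enumerates v (v ∷ concat ls)
    unique   pre-enumerates = All.tabulate (λ { u∈ refl → v∉blocks (pres-enum sub) u∈ })
                              ∷ blocks-unique children distinct (pres-enum sub)
    sound    pre-enumerates (here refl) = 0 , refl
    sound    pre-enumerates (there u∈) with block-of (pres-enum sub) u∈
    ... | c , c∈ , c↝u = below-v c∈ c↝u
    complete pre-enumerates v↝u with descendant-split v↝u
    ... | inj₁ refl            = here refl
    ... | inj₂ (c , c∈ , c↝u)  = there (in-block (pres-enum sub) c∈ c↝u)

    post-v : List (Fin n)
    post-v = concat (posts sub) ++ v ∷ []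

    post-enumerates : Enumerates v post-v
    unique   post-enumerates = ++⁺ (blocks-unique children distinct (posts-enum sub)) (All.[] ∷ [])
                                   λ { (v∈ , here refl) → v∉blocks (posts-enum sub) v∈ }
    sound    post-enumerates u∈ with ∈-++⁻ (concat (posts sub)) u∈
    ... | inj₂ (here refl) = 0 , refl
    ... | inj₁ u∈blocks with block-of (posts-enum sub) u∈blocks
    ...   | c , c∈ , c↝u = below-v c∈ c↝u
    complete post-enumerates v↝u with descendant-split v↝u
    ... | inj₁ refl           = ∈-++⁺ʳ (concat (posts sub)) (here refl)
    ... | inj₂ (c , c∈ , c↝u) = ∈-++⁺ˡ (in-block (posts-enum sub) c∈ c↝u)

    proper-in-blocks : ∀ {Ls u} → Pointwise Enumerates cs Ls → Anc v u → u ≢ v → u ∈ concat Ls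
    proper-in-blocks es v↝u u≢v with descendant-split v↝u
    ... | inj₁ u≡v            = ⊥-elim (u≢v u≡v)
    ... | inj₂ (c , c∈ , c↝u) = in-block es c∈ c↝u

    pre-ancestors-first : ∀ {a u} → Anc v a → ProperAnc a u → Precedes a u (v ∷ concat ls)
    pre-ancestors-first {a} v↝a (a↝u , a≢u) with a ≟ v
    ... | yes refl = at-head (proper-in-blocks (pres-enum sub) a↝u (λ u≡a → a≢u (sym u≡a)))
    ... | no a≢v   = in-tail (blocks-ancestors-first sub (proper-in-blocks (pres-enum sub) v↝a a≢v)
                                                     (a↝u , a≢u))

    post-descendants-first : ∀ {a u} → Anc v a → ProperAnc a u → Precedes u a post-v
    post-descendants-first {a} v↝a (a↝u , a≢u) with a ≟ v
    ... | yes refl = precedes-across (proper-in-blocks (posts-enum sub) a↝u (λ u≡a → a≢u (sym u≡a)))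
                                     (here refl)
    ... | no a≢v   = precedes-++ˡ (v ∷ [])
                       (blocks-descendants-first sub (proper-in-blocks (pres-enum sub) v↝a a≢v)
                                                 (a↝u , a≢u))

    -- v is an ancestor of everything after it, so an incomparable pair
    -- lies inside the blocks.
    pre-post-agree : ∀ {u w} → Incomparable u w → Precedes u w (v ∷ concat ls) → Precedes u w post-v
    pre-post-agree (u↛w , _) (at-head w∈) with block-of (pres-enum sub) w∈
    ... | c , c∈ , c↝w = ⊥-elim (u↛w (below-v c∈ c↝w))
    pre-post-agree inc (in-tail u<w) = precedes-++ˡ (v ∷ []) (blocks-incomparable-agree sub inc u<w)

    orders : Orders v (v ∷ concat ls)
    orders = record
      { pre-enum           = pre-enumerates
      ; post               = post-v
      ; post-enum          = post-enumerates
      ; ancestors-first    = pre-ancestors-first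
      ; descendants-first  = post-descendants-first
      ; incomparable-agree = pre-post-agree
      }

  mutual
    dfs-orders : ∀ {v xs} → DFSPreorder T v xs → Orders v xs
    dfs-orders {v} (visit cs distinct is-children ls subs) =
      Step.orders v cs distinct is-children ls (dfs-orders-all subs)

    dfs-orders-all : ∀ {cs ls} → Pointwise (DFSPreorder T) cs ls → Pointwise Orders cs ls
    dfs-orders-all []           = []
    dfs-orders-all (dfs ∷ subs) = dfs-orders dfs ∷ dfs-orders-all subs

module Orientations {n : ℕ} (T : RootedTree n) (E : Fin n → Fin n → Set)
                    {xs : List (Fin n)} (dfs : DFSPreorder T (root T) xs) where

  open TreeFacts T
  open DFSOrders T

  whole : Orders (root T) xs
  whole = dfs-orders dfs

  pre-unique : Unique xs
  pre-unique = Enumerates.unique (Orders.pre-enum whole)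

  post-unique : Unique (Orders.post whole)
  post-unique = Enumerates.unique (Orders.post-enum whole)

  ancestor-arc : ∀ {u w} → TreeArc T u w ⊎ BackArc T E u w → ProperAnc w u
  ancestor-arc (inj₁ tree)              = tree-arc-ancestor tree
  ancestor-arc (inj₂ (_ , w↝u , u≢w)) = w↝u , λ w≡u → u≢w (sym w≡u)

  forward-arc-ascends : ∀ {u w} → ArcFwd T E xs u w → Precedes u w (Orders.post whole)
  forward-arc-ascends (inj₁ tree) =
    Orders.descendants-first whole (reaches T _) (ancestor-arc (inj₁ tree))
  forward-arc-ascends (inj₂ (inj₁ back)) =
    Orders.descendants-first whole (reaches T _) (ancestor-arc (inj₂ back))
  forward-arc-ascends (inj₂ (inj₂ ((_ , inc) , u<w))) =
    Orders.incomparable-agree whole inc (before⇒precedes u<w)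

  backward-arc-descends : ∀ {u w} → ArcBwd T E xs u w → Precedes w u xs
  backward-arc-descends (inj₁ tree) =
    Orders.ancestors-first whole (reaches T _) (ancestor-arc (inj₁ tree))
  backward-arc-descends (inj₂ (inj₁ back)) =
    Orders.ancestors-first whole (reaches T _) (ancestor-arc (inj₂ back))
  backward-arc-descends (inj₂ (inj₂ (_ , w<u))) = before⇒precedes w<u

lemma1 : (n : ℕ) (T : RootedTree n) (E : Fin n → Fin n → Set) →
         (xs : List (Fin n)) → DFSPreorder T (root T) xs →
         Acyclic (ArcFwd T E xs) × Acyclic (ArcBwd T E xs)
lemma1 n T E xs dfs =
    acyclic-within forward-arc-ascends (precedes-trans post-unique) (precedes-irrefl post-unique)
  , acyclic-within backward-arc-descends (flip (precedes-trans pre-unique)) (precedes-irrefl pre-unique)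
  where open Orientations T E dfs
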